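{- Let $r$ and $s$ be positive integers with $r \geq s \geq 3$. If $\lfloor \frac{5s-1}{3} \rfloor - 1 < r \leq 2s - 2$, then $f(s,r,3) = 4s + 3r - 4$.
   Context: For integers $a\le b$, $[a,b]=\{n\in\mathbb{N} : a\le n\le b\}$. For a finite set $X\subseteq\mathbb{N}$, $\mathrm{diam}(X)=\max(X)-\min(X)$. $f(s,r,3)$ denotes the smallest positive integer $n$ such that for every coloring $\Delta:[1,n]\to\{1,2,3\}$ there exist subsets $S_1,S_2\subseteq[1,n]$ with: (a) $S_1$ and $S_2$ each monochromatic (not necessarily of the same color); (b) $|S_1|=s$, $|S_2|=r$; (c) $\max(S_1)<\min(S_2)$; (d) $\mathrm{diam}(S_1)\le\mathrm{diam}(S_2)$. -}

module Defs where

open import Data.Nat using (ℕ; zero; suc; _+_; _*_; _∸_; _≤_; _<_; _⊔_; _⊓_)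
open import Data.Fin using (Fin)
open import Data.List using (List; []; _∷_; length; foldr)
open import Data.List.Relation.Unary.All using (All)
open import Data.List.Relation.Unary.Linked using (Linked)
open import Data.Product using (Σ; _×_; ∃)
open import Relation.Binary.PropositionalEquality using (_≡_)
open import Relation.Nullary using (¬_)

-- A coloring of [1,n] with 3 colors; values outside [1,n] are irrelevant.
Coloring : Set
Coloring = ℕ → Fin 3

maxL : List ℕ → ℕ
maxL = foldr _⊔_ 0

minL : List ℕ → ℕ
minL []       = 0
minL (x ∷ xs) = foldr _⊓_ x xs

diam : List ℕ → ℕ
diam X = maxL X ∸ minL X

-- S is a subset of [1,n] of size k, monochromatic under Δ.
-- Finite sets are represented as strictly increasing lists.
MonoSubset : (n : ℕ) → Coloring → (k : ℕ) → List ℕ → Set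
MonoSubset n Δ k S =
  Linked _<_ S × length S ≡ k × All (λ x → 1 ≤ x × x ≤ n) S
  × Σ (Fin 3) (λ c → All (λ x → Δ x ≡ c) S)

Good : (s r n : ℕ) → Set
Good s r n = (Δ : Coloring) → Σ (List ℕ) λ S₁ → Σ (List ℕ) λ S₂ →
  MonoSubset n Δ s S₁ × MonoSubset n Δ r S₂
  × maxL S₁ < minL S₂ × diam S₁ ≤ diam S₂

IsF3 : (s r n : ℕ) → Set
IsF3 s r n = 1 ≤ n × Good s r n × ((m : ℕ) → 1 ≤ m → m < n → ¬ Good s r m)

-- Upper bound.  Put h = 3s − 2.  By pigeonhole some colour has s points in [1, h]; as a
-- first set they have diameter at most h − 1, so any colour e with at least r points after h
-- wins unless its first and last points after h are less than h apart.  The n − h = s + 3r − 2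
-- points after h are then counted: a colour with s + r of them splits into S₁ and S₂, two or
-- three colours with r of them are played against each other, and in every remaining
-- configuration the points after h do not fit.
-- Lower bound.  The colouring of [1, n − 1] by consecutive blocks of lengths
-- s − 1, s − 1, s − 1, r − s, s + r − 1, s, r − 1 coloured red, green, blue, red, green, red,
-- blue has no good pair: S₁ must end after 3(s − 1), so S₂ lies in the long green block, and
-- comparing diameters excludes every position of S₁.

module Submission where

open import Defs
open import Data.Nat using (ℕ; zero; suc; _+_; _*_; _∸_; _≤_; _<_; z≤n; s≤s; s≤s⁻¹; _≤?_; _<?_; _%_)
open import Data.Nat.Properties hiding (_≟_)
open import Data.Nat.DivMod using (_/_; m≡m%n+[m/n]*n; m%n<n)
open import Data.Nat.Tactic.RingSolver using (solve)
open import Data.Fin using (Fin; _≟_)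
import Data.Fin as Fin
open import Data.Fin.Properties using (all?; any?; ¬∀⟶∃¬)
open import Data.List using (List; []; _∷_; _++_; length; take; drop)
open import Data.List.Properties using (length-take; length-++)
open import Data.List.Relation.Unary.All using (All; []; _∷_)
  renaming (map to all-map; zipWith to all-zipWith; zip to all-zip; head to all-head; tail to all-tail)
open import Data.List.Relation.Unary.All.Properties using (take⁺; ++⁺; ++⁻ʳ)
open import Data.List.Relation.Unary.Linked using (Linked; []; [-]; _∷_)
import Data.List.Relation.Unary.Linked as Linked
open import Data.List.Relation.Unary.Linked.Properties using (Linked⇒All)
open import Data.Product using (Σ; ∃; ∃₂; _×_; _,_; proj₁; proj₂)
open import Data.Sum using (_⊎_; inj₁; inj₂)
open import Data.Empty using (⊥; ⊥-elim)
open import Data.Unit using (tt)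
open import Function using (_∘_; _∋_)
open import Relation.Binary using (tri<; tri≈; tri>)
open import Relation.Binary.PropositionalEquality
open import Relation.Nullary using (¬_; yes; no; Dec)
open import Relation.Nullary.Decidable using (¬?; _×-dec_; _⊎-dec_; _→-dec_; toWitness)

infixr 5 _⊕_

_⊕_ : ∀ {a b c d} → a ≤ b → c ≤ d → a + c ≤ b + d
_⊕_ = +-mono-≤

-- A linear contradiction is refuted by a certificate: a sum of hypotheses a ≤ b for which
-- a = 1 + b + k is a polynomial identity, checked by `solve`.  The solver only treats
-- variables as atoms, so certificates are stated over variables and instantiated later.
refute : ∀ {a b} k → a ≤ b → a ≡ suc (b + k) → ⊥
refute {a} {b} k a≤b a≡1+b+k = <⇒≱ (subst (b <_) (sym a≡1+b+k) (s≤s (m≤m+n b k))) a≤b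

width-arith : ∀ {k ca cb a b} → k + ca ≤ cb → cb + a ≤ ca + b → b < a + k → ⊥
width-arith {k} {ca} {cb} {a} {b} many gap b<a+k =
  refute 0 (b<a+k ⊕ many ⊕ gap) (solve (List ℕ ∋ k ∷ ca ∷ cb ∷ a ∷ b ∷ []))

interior-arith : ∀ {r x y} → 2 ≤ r → r + x ≤ suc y → (r ∸ 2) + suc x ≤ y
interior-arith {suc (suc t)} {x} {y} (s≤s (s≤s z≤n)) r+x≤1+y =
  subst (_≤ y) (sym (+-suc t x)) (s≤s⁻¹ r+x≤1+y)

∸≤∸⇒+≤+ : ∀ {a b c e} → b ≤ a → e ≤ c → a ∸ b ≤ c ∸ e → a + e ≤ c + b
∸≤∸⇒+≤+ {a} {b} {c} {e} b≤a e≤c a∸b≤c∸e = begin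
  a + e            ≡⟨ cong (_+ e) (m∸n+n≡m b≤a) ⟨
  a ∸ b + b + e    ≡⟨ +-assoc (a ∸ b) b e ⟩
  a ∸ b + (b + e)  ≤⟨ +-monoˡ-≤ (b + e) a∸b≤c∸e ⟩
  c ∸ e + (b + e)  ≡⟨ cong (c ∸ e +_) (+-comm b e) ⟩
  c ∸ e + (e + b)  ≡⟨ +-assoc (c ∸ e) e b ⟨
  c ∸ e + e + b    ≡⟨ cong (_+ b) (m∸n+n≡m e≤c) ⟩
  c + b            ∎
  where open ≤-Reasoning

pattern red = Fin.zero
pattern green = Fin.suc Fin.zero
pattern blue = Fin.suc (Fin.suc Fin.zero)

Distinct : Fin 3 → Fin 3 → Fin 3 → Set
Distinct a b c = a ≢ b × a ≢ c × b ≢ c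

distinct? : ∀ a b c → Dec (Distinct a b c)
distinct? a b c = ¬? (a ≟ b) ×-dec ¬? (a ≟ c) ×-dec ¬? (b ≟ c)

distinct-cover : ∀ a b c → Distinct a b c → ∀ d → d ≡ a ⊎ d ≡ b ⊎ d ≡ c
distinct-cover = toWitness
  {a? = all? λ a → all? λ b → all? λ c → distinct? a b c →-dec all? λ d → d ≟ a ⊎-dec d ≟ b ⊎-dec d ≟ c} tt

others : ∀ a → ∃ λ b → ∃ λ c → Distinct a b c
others = toWitness {a? = all? λ a → any? λ b → any? λ c → distinct? a b c} tt

third-colour : ∀ a c → a ≢ c → ∃ λ b → Distinct a b c
third-colour = toWitness {a? = all? λ a → all? λ c → ¬? (a ≟ c) →-dec any? λ b → distinct? a b c} tt

distinct-swap : ∀ {a b c} → Distinct a b c → Distinct a c b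
distinct-swap (a≢b , a≢c , b≢c) = a≢c , a≢b , b≢c ∘ sym

linked⇒below : ∀ {x xs} → Linked _<_ (x ∷ xs) → All (x <_) xs
linked⇒below [-] = []
linked⇒below (x<y ∷ l) = Linked⇒All <-trans x<y l

linked-∷ : ∀ {x xs} → All (x <_) xs → Linked _<_ xs → Linked _<_ (x ∷ xs)
linked-∷ [] _ = [-]
linked-∷ (x<y ∷ _) l = x<y ∷ l

take-linked : ∀ k {xs : List ℕ} → Linked _<_ xs → Linked _<_ (take k xs)
take-linked zero _ = []
take-linked (suc k) [] = []
take-linked (suc zero) [-] = [-]
take-linked (suc (suc k)) [-] = [-]
take-linked (suc zero) (_ ∷ _) = [-]
take-linked (suc (suc k)) (x<y ∷ l) = x<y ∷ take-linked (suc k) l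

linked-between : ∀ {x y} mid → x < y → All (λ m → x < m × m < y) mid → Linked _<_ mid →
                 Linked _<_ (x ∷ mid ++ y ∷ [])
linked-between [] x<y [] _ = x<y ∷ [-]
linked-between (m ∷ mid) x<y ((x<m , m<y) ∷ bounds) l =
  x<m ∷ linked-between mid m<y (all-zipWith (λ (m<z , (_ , z<y)) → m<z , z<y) (linked⇒below l , bounds))
                       (Linked.tail l)

maxL-≤ : ∀ {b xs} → All (_≤ b) xs → maxL xs ≤ b
maxL-≤ [] = z≤n
maxL-≤ (x≤b ∷ xs≤b) = ⊔-lub x≤b (maxL-≤ xs≤b)

≤-maxL : ∀ xs → All (_≤ maxL xs) xs
≤-maxL [] = []
≤-maxL (x ∷ xs) = m≤m⊔n x _ ∷ all-map (λ y≤ → ≤-trans y≤ (m≤n⊔m x _)) (≤-maxL xs)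

minL-≥ : ∀ {a x xs} → a ≤ x → All (a ≤_) xs → a ≤ minL (x ∷ xs)
minL-≥ a≤x [] = a≤x
minL-≥ a≤x (a≤y ∷ a≤ys) = ⊓-glb a≤y (minL-≥ a≤x a≤ys)

minL-≤ : ∀ x xs → All (minL (x ∷ xs) ≤_) (x ∷ xs)
minL-≤ x [] = ≤-refl ∷ []
minL-≤ x (y ∷ ys) with minL-≤ x ys
... | m≤x ∷ m≤ys = ≤-trans (m⊓n≤n y _) m≤x ∷ m⊓n≤m y _ ∷ all-map (≤-trans (m⊓n≤n y _)) m≤ys

≤-minL : ∀ {a p} xs → All (a <_) xs → minL xs ≡ suc p → a ≤ p
≤-minL [] _ ()
≤-minL (x ∷ xs) (a<x ∷ a<xs) min≡1+p = s≤s⁻¹ (subst (_ <_) min≡1+p (minL-≥ a<x a<xs))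

diam-≤ : ∀ {a b xs} → All (λ x → a < x × x ≤ b) xs → diam xs ≤ b ∸ suc a
diam-≤ [] = z≤n
diam-≤ {xs = x ∷ xs} bounds@((a<x , _) ∷ bounds′) =
  ∸-mono (maxL-≤ (all-map proj₂ bounds)) (minL-≥ a<x (all-map proj₁ bounds′))

diam-≥ : ∀ x mid y → y ∸ x ≤ diam (x ∷ mid ++ y ∷ [])
diam-≥ x mid y with ++⁻ʳ (x ∷ mid) (≤-maxL (x ∷ mid ++ y ∷ [])) | minL-≤ x (mid ++ y ∷ [])
... | y≤max ∷ [] | min≤x ∷ _ = ∸-mono y≤max min≤x

-- Counting the points of a colour

module Counting (Δ : Coloring) where

  count : Fin 3 → ℕ → ℕ
  count c zero = 0
  count c (suc x) with Δ (suc x) ≟ c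
  ... | yes _ = suc (count c x)
  ... | no _ = count c x

  -- A record rather than a synonym, so that k, c, a and b stay inferable: count is not injective.
  record AtLeast (k : ℕ) (c : Fin 3) (a b : ℕ) : Set where
    constructor at-least
    field counted : k + count c a ≤ count c b

  open AtLeast public

  count-hit : ∀ {c x} → Δ (suc x) ≡ c → count c (suc x) ≡ suc (count c x)
  count-hit {c} {x} hit with Δ (suc x) ≟ c
  ... | yes _ = refl
  ... | no miss = ⊥-elim (miss hit)

  count-miss : ∀ {c x} → Δ (suc x) ≢ c → count c (suc x) ≡ count c x
  count-miss {c} {x} miss with Δ (suc x) ≟ c
  ... | yes hit = ⊥-elim (miss hit)
  ... | no _ = refl

  count-≤-suc : ∀ c x → count c x ≤ count c (suc x)
  count-≤-suc c x with Δ (suc x) ≟ c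
  ... | yes _ = n≤1+n _
  ... | no _ = ≤-refl

  count-suc-≤ : ∀ c x → count c (suc x) ≤ suc (count c x)
  count-suc-≤ c x with Δ (suc x) ≟ c
  ... | yes _ = ≤-refl
  ... | no _ = n≤1+n _

  count-mono : ∀ c {x y} → x ≤ y → count c x ≤ count c y
  count-mono c {y = zero} z≤n = ≤-refl
  count-mono c {y = suc y} x≤1+y with m≤n⇒m<n∨m≡n x≤1+y
  ... | inj₁ x<1+y = ≤-trans (count-mono c (s≤s⁻¹ x<1+y)) (count-≤-suc c y)
  ... | inj₂ refl = ≤-refl

  count-gap : ∀ c {x y} → x ≤ y → count c y + x ≤ count c x + y
  count-gap c {y = zero} z≤n = ≤-refl
  count-gap c {x} {suc y} x≤1+y with m≤n⇒m<n∨m≡n x≤1+y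
  ... | inj₂ refl = ≤-refl
  ... | inj₁ x<1+y = begin
    count c (suc y) + x   ≤⟨ +-monoˡ-≤ x (count-suc-≤ c y) ⟩
    suc (count c y + x)   ≤⟨ s≤s (count-gap c (s≤s⁻¹ x<1+y)) ⟩
    suc (count c x + y)   ≡⟨ +-suc (count c x) y ⟨
    count c x + suc y     ∎
    where open ≤-Reasoning

  count-total : ∀ {a b c} → Distinct a b c → ∀ x → count a x + count b x + count c x ≡ x
  count-total d zero = refl
  count-total {a} {b} {c} d@(a≢b , a≢c , b≢c) (suc x) with distinct-cover a b c d (Δ (suc x))
  ... | inj₁ hit
    rewrite count-hit hit | count-miss (a≢b ∘ trans (sym hit)) | count-miss (a≢c ∘ trans (sym hit))
    = cong suc (count-total d x)
  ... | inj₂ (inj₁ hit)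
    rewrite count-miss ((a≢b ∘ sym) ∘ trans (sym hit)) | count-hit hit | count-miss (b≢c ∘ trans (sym hit))
    = trans (cong (_+ count c x) (+-suc (count a x) (count b x))) (cong suc (count-total d x))
  ... | inj₂ (inj₂ hit)
    rewrite count-miss ((a≢c ∘ sym) ∘ trans (sym hit)) | count-miss ((b≢c ∘ sym) ∘ trans (sym hit))
          | count-hit hit
    = trans (+-suc (count a x + count b x) (count c x)) (cong suc (count-total d x))

  count-reaches : ∀ c a b v → count c a < v → v ≤ count c b →
          ∃ λ w → a ≤ w × w < b × Δ (suc w) ≡ c × count c (suc w) ≡ v
  count-reaches c a zero v a<v v≤0 = ⊥-elim (n≮0 (<-≤-trans a<v v≤0))
  count-reaches c a (suc b) v a<v v≤ with v ≤? count c b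
  ... | yes v≤b with count-reaches c a b v a<v v≤b
  ...   | w , a≤w , w<b , hit , reached = w , a≤w , m<n⇒m<1+n w<b , hit , reached
  count-reaches c a (suc b) v a<v v≤ | no v≰b with Δ (suc b) ≟ c
  ... | no _ = ⊥-elim (v≰b v≤)
  ... | yes hit = b , a≤b , ≤-refl , hit , reached
    where
    reached : count c (suc b) ≡ v
    reached = trans (count-hit hit) (≤-antisym (≰⇒> v≰b) v≤)
    a≤b : a ≤ b
    a≤b = ≮⇒≥ λ b<a → <⇒≱ a<v (≤-trans (≤-reflexive (sym reached)) (count-mono c b<a))

  count-before-hit : ∀ {c w v} → Δ (suc w) ≡ c → count c (suc w) ≡ suc v → count c w ≡ v
  count-before-hit hit reached = suc-injective (trans (sym (count-hit hit)) reached)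

  left-of-hit : ∀ {c x y} → Δ (suc y) ≡ c → count c x ≤ count c y → x ≤ y
  left-of-hit {c} {x} {y} hit cx≤cy =
    ≮⇒≥ λ y<x → 1+n≰n (subst (_≤ count c y) (count-hit hit) (≤-trans (count-mono c y<x) cx≤cy))

  right-of-hit : ∀ {c x y} → Δ (suc y) ≡ c → count c (suc y) ≤ count c x → suc y ≤ x
  right-of-hit {c} {x} {y} hit cy≤cx =
    ≮⇒≥ λ x<1+y →
      1+n≰n (subst (_≤ count c y) (count-hit hit) (≤-trans cy≤cx (count-mono c (s≤s⁻¹ x<1+y))))

  atLeast⇒count< : ∀ {k c a b} → 1 ≤ k → AtLeast k c a b → count c a < count c b
  atLeast⇒count< 1≤k (at-least many) = ≤-trans (1≤k ⊕ ≤-refl) many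

  atLeast⇒< : ∀ {k c a b} → 1 ≤ k → AtLeast k c a b → a < b
  atLeast⇒< {c = c} 1≤k many = ≰⇒> λ b≤a → <⇒≱ (atLeast⇒count< 1≤k many) (count-mono c b≤a)

  atLeast-width : ∀ {k c a b} → 1 ≤ k → AtLeast k c a b → a + k ≤ b
  atLeast-width {c = c} 1≤k many =
    ≮⇒≥ (width-arith (counted many) (count-gap c (<⇒≤ (atLeast⇒< 1≤k many))))

  Points : Fin 3 → ℕ → ℕ → List ℕ → Set
  Points c a b S = Linked _<_ S × All (λ x → Δ x ≡ c × a < x × x ≤ b) S

  occurrences : Fin 3 → ℕ → ℕ → List ℕ
  occurrences c a zero = []
  occurrences c a (suc k) with Δ (suc a) ≟ c
  ... | yes _ = suc a ∷ occurrences c (suc a) k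
  ... | no _ = occurrences c (suc a) k

  points-weaken : ∀ {c a a′ b S} → a′ ≤ a → Points c a b S → Points c a′ b S
  points-weaken a′≤a (linked , bounds) =
    linked , all-map (λ (hit , a<x , x≤b) → hit , ≤-<-trans a′≤a a<x , x≤b) bounds

  occurrences-points : ∀ c a k {b} → a + k ≤ b → Points c a b (occurrences c a k)
  occurrences-points c a zero _ = [] , []
  occurrences-points c a (suc k) {b} a+1+k≤b with Δ (suc a) ≟ c
  ... | yes hit =
    linked-∷ (all-map (proj₁ ∘ proj₂) (proj₂ rest)) (proj₁ rest) ,
    (hit , ≤-refl , ≤-trans (s≤s (m≤m+n a k)) 1+a+k≤b) ∷ proj₂ (points-weaken (n≤1+n a) rest)
    where
    1+a+k≤b : suc a + k ≤ b
    1+a+k≤b = subst (_≤ b) (+-suc a k) a+1+k≤b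
    rest : Points c (suc a) b (occurrences c (suc a) k)
    rest = occurrences-points c (suc a) k 1+a+k≤b
  ... | no _ = points-weaken (n≤1+n a) (occurrences-points c (suc a) k (subst (_≤ b) (+-suc a k) a+1+k≤b))

  occurrences-length : ∀ c a k → length (occurrences c a k) + count c a ≡ count c (a + k)
  occurrences-length c a zero = cong (count c) (sym (+-identityʳ a))
  occurrences-length c a (suc k) with Δ (suc a) ≟ c
  ... | yes hit = begin
    suc (length rest + count c a)  ≡⟨ +-suc (length rest) (count c a) ⟨
    length rest + suc (count c a)  ≡⟨ cong (length rest +_) (count-hit hit) ⟨
    length rest + count c (suc a)  ≡⟨ occurrences-length c (suc a) k ⟩
    count c (suc a + k)            ≡⟨ cong (count c) (+-suc a k) ⟨
    count c (a + suc k)            ∎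
    where
    open ≡-Reasoning
    rest : List ℕ
    rest = occurrences c (suc a) k
  ... | no miss = begin
    length rest + count c a        ≡⟨ cong (length rest +_) (count-miss miss) ⟨
    length rest + count c (suc a)  ≡⟨ occurrences-length c (suc a) k ⟩
    count c (suc a + k)            ≡⟨ cong (count c) (+-suc a k) ⟨
    count c (a + suc k)            ∎
    where
    open ≡-Reasoning
    rest : List ℕ
    rest = occurrences c (suc a) k

  select : ∀ {k c a b} → a ≤ b → AtLeast k c a b → ∃ λ S → length S ≡ k × Points c a b S
  select {k} {c} {a} {b} a≤b (at-least many) =
    take k occ , trans (length-take k occ) (m≤n⇒m⊓n≡m enough) ,
    take-linked k (proj₁ points) , take⁺ k (proj₂ points)
    where
    a+[b∸a]≡b : a + (b ∸ a) ≡ b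
    a+[b∸a]≡b = m+[n∸m]≡n a≤b
    occ : List ℕ
    occ = occurrences c a (b ∸ a)
    points : Points c a b occ
    points = occurrences-points c a (b ∸ a) (≤-reflexive a+[b∸a]≡b)
    enough : k ≤ length occ
    enough = +-cancelʳ-≤ (count c a) k (length occ)
      (subst (k + count c a ≤_) (sym (trans (occurrences-length c a (b ∸ a)) (cong (count c) a+[b∸a]≡b)))
             many)

  Block : Fin 3 → ℕ → ℕ → Set
  Block c a k = ∀ {x} → a < x → x ≤ a + k → Δ x ≡ c

  block-init : ∀ {c a k} → Block c a (suc k) → Block c a k
  block-init {a = a} {k} block a<x x≤a+k = block a<x (≤-trans x≤a+k (+-monoʳ-≤ a (n≤1+n k)))

  block-last : ∀ {c a k} → Block c a (suc k) → Δ (suc (a + k)) ≡ c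
  block-last {a = a} {k} block = block (s≤s (m≤m+n a k)) (≤-reflexive (sym (+-suc a k)))

  count-block-hit : ∀ {c a} k → Block c a k → count c (a + k) ≡ count c a + k
  count-block-hit {c} {a} zero _ = trans (cong (count c) (+-identityʳ a)) (sym (+-identityʳ _))
  count-block-hit {c} {a} (suc k) block = begin
    count c (a + suc k)    ≡⟨ cong (count c) (+-suc a k) ⟩
    count c (suc (a + k))  ≡⟨ count-hit (block-last block) ⟩
    suc (count c (a + k))  ≡⟨ cong suc (count-block-hit k (block-init block)) ⟩
    suc (count c a + k)    ≡⟨ +-suc (count c a) k ⟨
    count c a + suc k      ∎
    where open ≡-Reasoning

  count-block-miss : ∀ {c e a} k → Block c a k → e ≢ c → count e (a + k) ≡ count e a
  count-block-miss {a = a} zero _ _ = cong (count _) (+-identityʳ a)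
  count-block-miss {c} {e} {a} (suc k) block e≢c = begin
    count e (a + suc k)    ≡⟨ cong (count e) (+-suc a k) ⟩
    count e (suc (a + k))  ≡⟨ count-miss (e≢c ∘ sym ∘ trans (sym (block-last block))) ⟩
    count e (a + k)        ≡⟨ count-block-miss k (block-init block) e≢c ⟩
    count e a              ∎
    where open ≡-Reasoning

  points-count : ∀ {c lo hi} xs → lo ≤ hi → Points c lo hi xs → length xs + count c lo ≤ count c hi
  points-count {c} [] lo≤hi _ = count-mono c lo≤hi
  points-count (zero ∷ _) _ (_ , (_ , () , _) ∷ _)
  points-count {c} {lo} {hi} (suc w ∷ xs) _ (linked , (hit , lo<x , x≤hi) ∷ bounds) = begin
    suc (length xs + count c lo)  ≡⟨ +-suc (length xs) (count c lo) ⟨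
    length xs + suc (count c lo)  ≤⟨ +-monoʳ-≤ (length xs) (s≤s (count-mono c (s≤s⁻¹ lo<x))) ⟩
    length xs + suc (count c w)   ≡⟨ cong (length xs +_) (count-hit hit) ⟨
    length xs + count c (suc w)   ≤⟨ points-count xs x≤hi (Linked.tail linked , tail-bounds) ⟩
    count c hi                    ∎
    where
    open ≤-Reasoning
    tail-bounds : All (λ y → Δ y ≡ c × suc w < y × y ≤ hi) xs
    tail-bounds =
      all-zipWith (λ (w<y , (hit′ , _ , y≤hi)) → hit′ , w<y , y≤hi) (linked⇒below linked , bounds)

  monochromatic-run : ∀ {m k S} → 1 ≤ k → MonoSubset m Δ k S →
                      ∃₂ λ c p → minL S ≡ suc p × AtLeast k c p (maxL S) × maxL S ≤ m ×
                                 Points c p (maxL S) S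
  monochromatic-run {S = []} 1≤k (_ , refl , _) = ⊥-elim (1+n≰n 1≤k)
  monochromatic-run {k = k} {S@(x ∷ xs)} 1≤k (linked , len , range , c , colours)
    with minL S | minL-≤ x xs
       | minL-≥ {a = 1} {x} {xs} (proj₁ (all-head range)) (all-map proj₁ (all-tail range))
  ... | zero | _ | ()
  ... | suc p | min≤ | _ = c , p , refl , at-least many , maxL-≤ (all-map proj₂ range) , linked , points
    where
    points : All (λ y → Δ y ≡ c × p < y × y ≤ maxL S) S
    points = all-zip (colours , all-zip (min≤ , ≤-maxL S))
    p≤max : p ≤ maxL S
    p≤max = ≤-trans (n≤1+n p) (≤-trans (all-head min≤) (all-head (≤-maxL S)))
    many : k + count c p ≤ count c (maxL S)
    many = subst (λ t → t + count c p ≤ count c (maxL S)) len (points-count S p≤max (linked , points))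

GoodPair : ℕ → ℕ → ℕ → Coloring → Set
GoodPair s r n Δ = Σ (List ℕ) λ S₁ → Σ (List ℕ) λ S₂ →
  MonoSubset n Δ s S₁ × MonoSubset n Δ r S₂ × maxL S₁ < minL S₂ × diam S₁ ≤ diam S₂

module Pairs (Δ : Coloring) (s r n : ℕ) (1≤s : 1 ≤ s) (2≤r : 2 ≤ r) where
  open Counting Δ

  set-in-window : ∀ {c a b} → AtLeast s c a b → b ≤ n →
                  ∃ λ S → MonoSubset n Δ s S × maxL S ≤ b × diam S ≤ b ∸ suc a
  set-in-window {c} many b≤n with select (<⇒≤ (atLeast⇒< 1≤s many)) many
  ... | S , len , linked , points =
    S , (linked , len , all-map (λ (_ , a<x , x≤b) → ≤-trans (s≤s z≤n) a<x , ≤-trans x≤b b≤n) points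
                , c , all-map proj₁ points)
      , maxL-≤ (all-map (proj₂ ∘ proj₂) points) , diam-≤ (all-map proj₂ points)

  set-spanning : ∀ {c w v} → Δ (suc w) ≡ c → Δ (suc v) ≡ c → AtLeast r c w (suc v) → suc v ≤ n →
                 ∃ λ S → MonoSubset n Δ r S × suc w ≤ minL S × v ∸ w ≤ diam S
  set-spanning {c} {w} {v} first-hit last-hit many 1+v≤n = assemble (select 1+w≤v interior)
    where
    interior : AtLeast (r ∸ 2) c (suc w) v
    interior = at-least (subst (λ t → r ∸ 2 + t ≤ count c v) (sym (count-hit first-hit))
      (interior-arith 2≤r (subst (r + count c w ≤_) (count-hit last-hit) (counted many))))
    1+w≤v : suc w ≤ v
    1+w≤v = right-of-hit first-hit (m+n≤o⇒n≤o (r ∸ 2) (counted interior))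
    v≤n : v ≤ n
    v≤n = ≤-trans (n≤1+n v) 1+v≤n
    assemble : (∃ λ mid → length mid ≡ r ∸ 2 × Points c (suc w) v mid) →
               ∃ λ S → MonoSubset n Δ r S × suc w ≤ minL S × v ∸ w ≤ diam S
    assemble (mid , len-mid , linked-mid , points-mid) =
      S , (linked , len , range , c , first-hit ∷ ++⁺ (all-map proj₁ points-mid) (last-hit ∷ []))
        , minL-≥ ≤-refl (++⁺ (all-map (λ (_ , w<x , _) → <⇒≤ w<x) points-mid) (≤-trans 1+w≤v (n≤1+n v) ∷ []))
        , diam-≥ (suc w) mid (suc v)
      where
      S : List ℕ
      S = suc w ∷ mid ++ suc v ∷ []
      range : All (λ x → 1 ≤ x × x ≤ n) S
      range = (s≤s z≤n , ≤-trans 1+w≤v v≤n)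
            ∷ ++⁺ (all-map (λ (_ , w<x , x≤v) → ≤-trans (s≤s z≤n) w<x , ≤-trans x≤v v≤n) points-mid)
                  ((s≤s z≤n , 1+v≤n) ∷ [])
      linked : Linked _<_ S
      linked = linked-between mid (s≤s 1+w≤v) (all-map (λ (_ , w<x , x≤v) → w<x , s≤s x≤v) points-mid) linked-mid
      len : length S ≡ r
      len = begin
        suc (length (mid ++ suc v ∷ []))  ≡⟨ cong suc (length-++ mid) ⟩
        suc (length mid + 1)              ≡⟨ cong (λ t → suc (t + 1)) len-mid ⟩
        suc (r ∸ 2 + 1)                   ≡⟨ cong suc (+-comm (r ∸ 2) 1) ⟩
        2 + (r ∸ 2)                       ≡⟨ m+[n∸m]≡n 2≤r ⟩
        r                                 ∎
        where open ≡-Reasoning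

  -- diam S₁ ≤ b − a − 1 ≤ y − w − 1 ≤ diam S₂.
  window-pair : ∀ {c₁ a b c₂ w y} → AtLeast s c₁ a b → Δ (suc w) ≡ c₂ → Δ y ≡ c₂ →
                AtLeast r c₂ w y → b ≤ w → y ≤ n → b + w ≤ y + a → GoodPair s r n Δ
  window-pair {y = zero} _ _ _ (at-least many₂) _ _ _ =
    ⊥-elim (<⇒≱ (≤-trans (s≤s z≤n) (≤-trans 2≤r (m≤m+n r _))) many₂)
  window-pair {a = a} {b} {w = w} {suc v} many₁ first-hit last-hit many₂ b≤w 1+v≤n b+w≤1+v+a
    with set-in-window many₁ (≤-trans b≤w (≤-trans (<⇒≤ w<1+v) 1+v≤n)) | set-spanning first-hit last-hit many₂ 1+v≤n
    where
    w<1+v : w < suc v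
    w<1+v = atLeast⇒< (≤-trans (s≤s z≤n) 2≤r) many₂
  ... | S₁ , mono₁ , max₁≤b , diam₁≤ | S₂ , mono₂ , w<min₂ , ≤diam₂ =
    S₁ , S₂ , mono₁ , mono₂ , ≤-<-trans max₁≤b (<-≤-trans (s≤s b≤w) w<min₂) , ≤-trans diam₁≤ (≤-trans widths ≤diam₂)
    where
    w≤v : w ≤ v
    w≤v = s≤s⁻¹ (atLeast⇒< (≤-trans (s≤s z≤n) 2≤r) many₂)
    widths : b ∸ suc a ≤ v ∸ w
    widths = m≤n+o⇒m∸n≤o b (suc a) (begin
      b                      ≤⟨ m+n≤o⇒m≤o∸n b b+w≤1+v+a ⟩
      (suc v + a) ∸ w        ≡⟨ cong (_∸ w) (+-suc v a) ⟨
      (v + suc a) ∸ w        ≡⟨ +-∸-comm (suc a) w≤v ⟩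
      (v ∸ w) + suc a        ≡⟨ +-comm (v ∸ w) (suc a) ⟩
      suc a + (v ∸ w)        ∎)
      where open ≤-Reasoning

  pair-unless-narrower : ∀ {c₁ a b c₂ w y} → AtLeast s c₁ a b → Δ (suc w) ≡ c₂ → Δ y ≡ c₂ →
                         AtLeast r c₂ w y → b ≤ w → y ≤ n →
                         (y + a < b + w → GoodPair s r n Δ) → GoodPair s r n Δ
  pair-unless-narrower {a = a} {b} {w = w} {y} many₁ first-hit last-hit many₂ b≤w y≤n narrower
    with b + w ≤? y + a
  ... | yes wide = window-pair many₁ first-hit last-hit many₂ b≤w y≤n wide
  ... | no ¬wide = narrower (≰⇒> ¬wide)

-- Upper bound

-- h = 3s − 2 and n = 4s + 3r − 4 are kept as variables, so that no truncated subtraction occurs.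
record Parameters (s s′ r h n : ℕ) : Set where
  field
    s≡1+s′ : s ≡ suc s′
    s<r : s < r
    3s≤2r+2 : 3 * s ≤ 2 * r + 2
    5s≤3r+3 : 5 * s ≤ 3 * r + 3
    h+2≡3s : h + 2 ≡ 3 * s
    n+4≡4s+3r : n + 4 ≡ 4 * s + 3 * r

module UpperBound {s s′ r h n : ℕ} (p : Parameters s s′ r h n) (Δ : Coloring) where
  open Parameters p
  open Counting Δ

  h+2≤3s : h + 2 ≤ 3 * s
  h+2≤3s = ≤-reflexive h+2≡3s
  3s≤h+2 : 3 * s ≤ h + 2
  3s≤h+2 = ≤-reflexive (sym h+2≡3s)
  4s+3r≤n+4 : 4 * s + 3 * r ≤ n + 4
  4s+3r≤n+4 = ≤-reflexive (sym n+4≡4s+3r)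
  s≤1+s′ : s ≤ suc s′
  s≤1+s′ = ≤-reflexive s≡1+s′
  1+s′≤s : suc s′ ≤ s
  1+s′≤s = ≤-reflexive (sym s≡1+s′)
  1≤s : 1 ≤ s
  1≤s = ≤-trans (s≤s z≤n) 1+s′≤s
  2≤r : 2 ≤ r
  2≤r = ≤-trans (s≤s 1≤s) s<r
  1≤r : 1 ≤ r
  1≤r = ≤-trans (s≤s z≤n) 2≤r

  open Pairs Δ s r n 1≤s 2≤r

  Pair : Set
  Pair = GoodPair s r n Δ

  crowded-prefix : ∃ λ c → AtLeast s c 0 h
  crowded-prefix with any? (λ c → s + 0 ≤? count c h)
  ... | yes (c , crowded) = c , at-least crowded
  ... | no none =
    ⊥-elim (pigeonhole (count-total ((λ ()) , (λ ()) , (λ ())) h) (below red) (below green) (below blue))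
    where
    below : ∀ c → count c h < s + 0
    below c = ≰⇒> (none ∘ (c ,_))
    pigeonhole : ∀ {x y z} → x + y + z ≡ h → x < s + 0 → y < s + 0 → z < s + 0 → ⊥
    pigeonhole {x} {y} {z} total x< y< z< =
      refute 0 (≤-reflexive (sym total) ⊕ x< ⊕ y< ⊕ z< ⊕ 3s≤h+2) (solve (List ℕ ∋ x ∷ y ∷ z ∷ s ∷ h ∷ []))

  module _ {c₀ : Fin 3} (crowded : AtLeast s c₀ 0 h) where

    pair-unless-short : ∀ {e w y} → Δ (suc w) ≡ e → Δ y ≡ e → AtLeast r e w y → h ≤ w → y ≤ n →
                        (y < h + w → Pair) → Pair
    pair-unless-short {w = w} {y} first-hit last-hit many h≤w y≤n short =
      pair-unless-narrower crowded first-hit last-hit many h≤w y≤n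
        (short ∘ subst (λ t → suc t ≤ h + w) (+-identityʳ y))

    record Span (e : Fin 3) : Set where
      field
        first last : ℕ
        first-hit : Δ (suc first) ≡ e
        first-count : count e first ≡ count e h
        last-hit : Δ (suc last) ≡ e
        last-count : count e (suc last) ≡ count e n
        last<n : suc last ≤ n
        first≤last : first ≤ last
        many : AtLeast r e first (suc last)
        short : suc (suc last) ≤ h + first

    open Span public

    spanned : ∀ {e} → AtLeast r e h n → (Span e → Pair) → Pair
    spanned {e} large k
      with count-reaches e h n (suc (count e h)) ≤-refl (atLeast⇒count< 1≤r large)
         | count-reaches e h n (count e n) (atLeast⇒count< 1≤r large) ≤-refl
    ... | f , h≤f , _ , f-hit , f-reached | l , _ , l<n , l-hit , l-reached =
      pair-unless-short f-hit l-hit (at-least window) h≤f l<n λ short → k (record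
        { first = f ; last = l ; first-hit = f-hit ; first-count = f-count
        ; last-hit = l-hit ; last-count = l-reached ; last<n = l<n
        ; first≤last = s≤s⁻¹ (right-of-hit f-hit (subst₂ _≤_ (sym f-reached) (sym l-reached)
                                                          (atLeast⇒count< 1≤r large)))
        ; many = at-least window ; short = short })
      where
      f-count : count e f ≡ count e h
      f-count = count-before-hit f-hit f-reached
      window : r + count e f ≤ count e (suc l)
      window = subst₂ (λ a b → r + a ≤ b) (sym f-count) (sym l-reached) (counted large)

    -- With s + r points of e after h, the first s of them and the remaining ones form a pair.
    bounded : ∀ e → (count e n < s + r + count e h → Pair) → Pair
    bounded e k with s + r + count e h ≤? count e n
    ... | no ¬many = k (≰⇒> ¬many)
    ... | yes many = spanned (at-least (≤-trans (m≤n+m (r + count e h) s) s+r+h≤n)) split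
      where
      s+r+h≤n : s + (r + count e h) ≤ count e n
      s+r+h≤n = ≤-trans (≤-reflexive (sym (+-assoc s r _))) many
      split : Span e → Pair
      split sp with count-reaches e h n (s + count e h) (+-monoˡ-≤ _ 1≤s)
                                  (≤-trans (+-monoʳ-≤ s (m≤n+m _ r)) s+r+h≤n)
      ... | z , _ , _ , z-hit , z-reached
        with count-reaches e (suc z) n (suc (s + count e h)) (s≤s (≤-reflexive z-reached))
               (subst (_≤ count e n) (+-suc s _) (≤-trans (+-monoʳ-≤ s (+-monoˡ-≤ _ 1≤r)) s+r+h≤n))
      ... | x , z<x , _ , x-hit , x-reached =
        pair-unless-narrower first-window x-hit (last-hit sp) (at-least second-window) z<x (last<n sp)
          (⊥-elim ∘ too-short (atLeast-width 1≤r (at-least second-window)) z<x (short sp))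
        where
        first-window : AtLeast s e (first sp) (suc z)
        first-window = at-least (≤-reflexive (trans (cong (s +_) (first-count sp)) (sym z-reached)))
        second-window : r + count e x ≤ count e (suc (last sp))
        second-window =
          subst₂ (λ a b → r + a ≤ b) (sym (count-before-hit x-hit x-reached)) (sym (last-count sp))
            (≤-trans (≤-reflexive (trans (sym (+-assoc r s _)) (cong (_+ count e h) (+-comm r s)))) many)
        too-short : ∀ {f z x l} → x + r ≤ suc l → suc z ≤ x → suc (suc l) ≤ h + f →
                    suc (suc l + f) ≤ suc z + x → ⊥
        too-short {f} {z} {x} {l} wide z<x short narrower =
          refute 1 (wide ⊕ wide ⊕ narrower ⊕ z<x ⊕ short ⊕ h+2≤3s ⊕ 3s≤2r+2)
            (solve (List ℕ ∋ f ∷ z ∷ x ∷ l ∷ s ∷ r ∷ h ∷ []))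

    not-all-small : ∀ {a b c} → Distinct a b c → count a n < s + r + count a h →
                    count b n < r + count b h → count c n < r + count c h → ⊥
    not-all-small dist = arith (count-total dist n) (count-total dist h)
      where
      arith : ∀ {an bn cn ah bh ch} → an + bn + cn ≡ n → ah + bh + ch ≡ h →
              an < s + r + ah → bn < r + bh → cn < r + ch → ⊥
      arith {an} {bn} {cn} {ah} {bh} {ch} total-n total-h a< b< c< =
        refute 0 (≤-reflexive (sym total-n) ⊕ ≤-reflexive total-h ⊕ a< ⊕ b< ⊕ c< ⊕ h+2≤3s ⊕ 4s+3r≤n+4)
          (solve (List ℕ ∋ an ∷ bn ∷ cn ∷ ah ∷ bh ∷ ch ∷ s ∷ r ∷ h ∷ n ∷ []))

    module TwoLarge {a b c : Fin 3} (dist : Distinct a b c) (small : count a n < r + count a h)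
                    (sb : Span b) (sc : Span c) (fb<fc : first sb < first sc) where

      -- S₁: the first s points of b after h; S₂: all points of c after h.
      b-first : s + count b h ≤ count b (first sc) → Pair
      b-first early with count-reaches b h (first sc) (s + count b h) (+-monoˡ-≤ _ 1≤s) early
      ... | z , _ , z<fc , z-hit , z-reached =
        pair-unless-narrower (at-least (≤-reflexive (trans (cong (s +_) (first-count sb)) (sym z-reached))))
          (first-hit sc) (last-hit sc) (many sc) z<fc (last<n sc)
          (⊥-elim ∘ arith (count-total dist n) (count-total dist h) small gap-c gap-b (short sb))
        where
        gap-c : count c n + first sc ≤ count c h + suc (last sc)
        gap-c = subst₂ (λ x y → x + first sc ≤ y + suc (last sc)) (last-count sc) (first-count sc)
          (count-gap c (≤-trans (first≤last sc) (n≤1+n _)))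
        z<lb : suc z ≤ suc (last sb)
        z<lb = right-of-hit z-hit (subst (_≤ count b (suc (last sb))) (sym z-reached)
          (≤-trans (+-monoˡ-≤ _ (<⇒≤ s<r))
                   (subst (λ t → r + t ≤ count b (suc (last sb))) (first-count sb) (counted (many sb)))))
        gap-b : count b n + suc z ≤ (s + count b h) + suc (last sb)
        gap-b = subst₂ (λ x y → x + suc z ≤ y + suc (last sb)) (last-count sb) z-reached (count-gap b z<lb)
        arith : ∀ {an bn cn ah bh ch fb lb fc lc z} → an + bn + cn ≡ n → ah + bh + ch ≡ h → an < r + ah →
                cn + fc ≤ ch + suc lc → bn + suc z ≤ (s + bh) + suc lb → suc (suc lb) ≤ h + fb →
                suc (suc lc + fb) ≤ suc z + fc → ⊥
        arith {an} {bn} {cn} {ah} {bh} {ch} {fb} {lb} {fc} {lc} {z} total-n total-h a< gap-c gap-b short-b narrower =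
          refute 0 (≤-reflexive (sym total-n) ⊕ ≤-reflexive total-h ⊕ a< ⊕ gap-c ⊕ gap-b ⊕ short-b ⊕ narrower
                    ⊕ h+2≤3s ⊕ h+2≤3s ⊕ 4s+3r≤n+4 ⊕ 3s≤2r+2)
            (solve (List ℕ ∋ an ∷ bn ∷ cn ∷ ah ∷ bh ∷ ch ∷ fb ∷ lb ∷ fc ∷ lc ∷ z ∷ s ∷ r ∷ h ∷ n ∷ []))

      -- All points of b and c after h lie in the span of b, which is shorter than h.
      c-inside-b : last sc < last sb → ⊥
      c-inside-b lc<lb =
        arith (count-total dist n) (count-total dist h) small
              (count-total dist (suc (last sb))) (count-total dist (first sb)) (last-count sb) (first-count sb)
              (subst (_≤ count c (suc (last sb))) (last-count sc) (count-mono c (s≤s (<⇒≤ lc<lb))))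
              (subst (count c (first sb) ≤_) (first-count sc) (count-mono c (<⇒≤ fb<fc)))
              (count-mono a (≤-trans (first≤last sb) (n≤1+n _))) (short sb)
        where
        arith : ∀ {an bn cn ah bh ch a₁ b₁ c₁ a₀ b₀ c₀ fb lb} → an + bn + cn ≡ n → ah + bh + ch ≡ h →
                an < r + ah → a₁ + b₁ + c₁ ≡ suc lb → a₀ + b₀ + c₀ ≡ fb → b₁ ≡ bn → b₀ ≡ bh →
                cn ≤ c₁ → c₀ ≤ ch → a₀ ≤ a₁ → suc (suc lb) ≤ h + fb → ⊥
        arith {an} {bn} {cn} {ah} {bh} {ch} {a₁} {b₁} {c₁} {a₀} {b₀} {c₀} {fb} {lb}
              total-n total-h a< total₁ total₀ b₁≡bn b₀≡bh cn≤c₁ c₀≤ch a₀≤a₁ short-b =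
          refute 3 (≤-reflexive (sym total-n) ⊕ ≤-reflexive total-h ⊕ a< ⊕ ≤-reflexive total₁
                    ⊕ ≤-reflexive (sym total₀) ⊕ ≤-reflexive (sym b₁≡bn) ⊕ ≤-reflexive b₀≡bh
                    ⊕ cn≤c₁ ⊕ c₀≤ch ⊕ a₀≤a₁ ⊕ short-b ⊕ h+2≤3s ⊕ h+2≤3s ⊕ 4s+3r≤n+4 ⊕ s<r ⊕ s<r)
            (solve (List ℕ ∋ an ∷ bn ∷ cn ∷ ah ∷ bh ∷ ch ∷ a₁ ∷ b₁ ∷ c₁ ∷ a₀ ∷ b₀ ∷ c₀ ∷ fb ∷ lb ∷ s ∷ r ∷ h ∷ n ∷ []))

      -- All points of b and c after h, except fewer than s, lie in the span of c.
      b-inside-c : count b (first sc) < s + count b h → last sb ≤ last sc → ⊥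
      b-inside-c late lb≤lc =
        arith (count-total dist n) (count-total dist h) small
              (count-total dist (suc (last sc))) (last-count sc) (count-total dist (first sc)) (first-count sc)
              (subst (_≤ count b (suc (last sc))) (last-count sb) (count-mono b (s≤s lb≤lc)))
              late (count-mono a (≤-trans (first≤last sc) (n≤1+n _))) (short sc)
        where
        arith : ∀ {an bn cn ah bh ch a₁ b₁ c₁ a₀ b₀ c₀ fc lc} → an + bn + cn ≡ n → ah + bh + ch ≡ h →
                an < r + ah → a₁ + b₁ + c₁ ≡ suc lc → c₁ ≡ cn → a₀ + b₀ + c₀ ≡ fc → c₀ ≡ ch →
                bn ≤ b₁ → b₀ < s + bh → a₀ ≤ a₁ → suc (suc lc) ≤ h + fc → ⊥
        arith {an} {bn} {cn} {ah} {bh} {ch} {a₁} {b₁} {c₁} {a₀} {b₀} {c₀} {fc} {lc}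
              total-n total-h a< total₁ c₁≡cn total₀ c₀≡ch bn≤b₁ b₀< a₀≤a₁ short-c =
          refute 0 (≤-reflexive (sym total-n) ⊕ ≤-reflexive total-h ⊕ a< ⊕ ≤-reflexive total₁
                    ⊕ ≤-reflexive (sym c₁≡cn) ⊕ ≤-reflexive (sym total₀) ⊕ ≤-reflexive c₀≡ch
                    ⊕ bn≤b₁ ⊕ b₀< ⊕ a₀≤a₁ ⊕ short-c ⊕ h+2≤3s ⊕ h+2≤3s ⊕ 4s+3r≤n+4 ⊕ 3s≤2r+2)
            (solve (List ℕ ∋ an ∷ bn ∷ cn ∷ ah ∷ bh ∷ ch ∷ a₁ ∷ b₁ ∷ c₁ ∷ a₀ ∷ b₀ ∷ c₀ ∷ fc ∷ lc ∷ s ∷ r ∷ h ∷ n ∷ []))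

      pair : Pair
      pair with s + count b h ≤? count b (first sc) | last sc <? last sb
      ... | yes early | _ = b-first early
      ... | no late | yes lc<lb = ⊥-elim (c-inside-b lc<lb)
      ... | no late | no lc≮lb = ⊥-elim (b-inside-c (≰⇒> late) (≮⇒≥ lc≮lb))

    two-large : ∀ {a b c} → Distinct a b c → count a n < r + count a h → AtLeast r b h n → AtLeast r c h n →
                Pair
    two-large {a} {b} {c} dist@(_ , _ , b≢c) small large-b large-c =
      spanned large-b λ sb → spanned large-c λ sc → ordered sb sc
      where
      ordered : Span b → Span c → Pair
      ordered sb sc with <-cmp (first sb) (first sc)
      ... | tri< fb<fc _ _ = TwoLarge.pair dist small sb sc fb<fc
      ... | tri> _ _ fc<fb = TwoLarge.pair (distinct-swap dist) small sc sb fc<fb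
      ... | tri≈ _ same _ =
        ⊥-elim (b≢c (trans (sym (first-hit sb)) (subst (λ t → Δ (suc t) ≡ c) (sym same) (first-hit sc))))

    -- lx + 1 is the last point of x, and fz + 1 the first point of z after h.
    module ThreeLarge {x y z : Fin 3} (dist : Distinct x y z)
                      (lx : ℕ) (lx-count : count x (suc lx) ≡ count x n) (x-short : suc lx < h + h)
                      (sy : Span y)
                      (fz : ℕ) (fz-hit : Δ (suc fz) ≡ z) (z-last : Δ n ≡ z) (fz-count : count z fz ≡ count z h)
                      (z-many : AtLeast r z fz n) (z-short : n < h + fz) where

      -- S₁: the points of x in (h, h + s]; S₂: all points of y after h.
      late-y : h + s ≤ first sy → Pair
      late-y late =
        pair-unless-narrower x-window (first-hit sy) (last-hit sy) (many sy) late (last<n sy)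
          (⊥-elim ∘ arith (atLeast-width 1≤r (many sy)))
        where
        z-late : fz < h + s → ⊥
        z-late fz<h+s =
          refute 4 (fz<h+s ⊕ z-short ⊕ h+2≤3s ⊕ h+2≤3s ⊕ 4s+3r≤n+4 ⊕ s<r ⊕ s<r ⊕ s<r)
            (solve (List ℕ ∋ fz ∷ s ∷ r ∷ h ∷ n ∷ []))
        x-fills : ∀ {x₁ y₁ z₁ xh yh zh} → x₁ + y₁ + z₁ ≡ h + s → xh + yh + zh ≡ h → y₁ ≤ yh → z₁ ≤ zh →
                 x₁ < s + xh → ⊥
        x-fills {x₁} {y₁} {z₁} {xh} {yh} {zh} total₁ total-h y₁≤ z₁≤ x₁< =
          refute 0 (x₁< ⊕ ≤-reflexive (sym total₁) ⊕ ≤-reflexive total-h ⊕ y₁≤ ⊕ z₁≤)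
            (solve (List ℕ ∋ x₁ ∷ y₁ ∷ z₁ ∷ xh ∷ yh ∷ zh ∷ s ∷ h ∷ []))
        x-window : AtLeast s x h (h + s)
        x-window = at-least (≮⇒≥ (x-fills (count-total dist (h + s)) (count-total dist h)
          (subst (count y (h + s) ≤_) (first-count sy) (count-mono y late))
          (subst (count z (h + s) ≤_) fz-count (count-mono z (≮⇒≥ z-late)))))
        arith : ∀ {f l} → f + r ≤ suc l → suc (suc l + h) ≤ h + s + f → ⊥
        arith {f} {l} wide narrower = refute 1 (narrower ⊕ wide ⊕ s<r) (solve (List ℕ ∋ f ∷ l ∷ s ∷ r ∷ h ∷ []))

      z-after-window : h + s + s′ ≤ fz
      z-after-window = ≮⇒≥ z-early
        where
        z-early : fz < h + s + s′ → ⊥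
        z-early fz< = refute s′ (fz< ⊕ z-short ⊕ h+2≤3s ⊕ h+2≤3s ⊕ 4s+3r≤n+4 ⊕ 1+s′≤s ⊕ 1+s′≤s ⊕ 5s≤3r+3)
          (solve (List ℕ ∋ fz ∷ s ∷ s′ ∷ r ∷ h ∷ n ∷ []))

      crowded-window : ∃ λ c → AtLeast s c h (h + s + s′)
      crowded-window with s + count x h ≤? count x (h + s + s′)
      ... | yes enough = x , at-least enough
      ... | no ¬enough = y , at-least (≮⇒≥ (y-fills (count-total dist (h + s + s′)) (count-total dist h) (≰⇒> ¬enough)
                               (subst (count z (h + s + s′) ≤_) fz-count (count-mono z z-after-window))))
        where
        y-fills : ∀ {x₁ y₁ z₁ xh yh zh} → x₁ + y₁ + z₁ ≡ h + s + s′ → xh + yh + zh ≡ h → x₁ < s + xh →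
                 z₁ ≤ zh → y₁ < s + yh → ⊥
        y-fills {x₁} {y₁} {z₁} {xh} {yh} {zh} total₁ total-h x₁< z₁≤ y₁< =
          refute 0 (y₁< ⊕ ≤-reflexive (sym total₁) ⊕ ≤-reflexive total-h ⊕ x₁< ⊕ z₁≤ ⊕ s≤1+s′)
            (solve (List ℕ ∋ x₁ ∷ y₁ ∷ z₁ ∷ xh ∷ yh ∷ zh ∷ s ∷ s′ ∷ h ∷ []))

      probe≤n : suc (h + 4 * s′) ≤ n
      probe≤n = ≮⇒≥ arith
        where
        arith : n < suc (h + 4 * s′) → ⊥
        arith n< = refute 4 (n< ⊕ h+2≤3s ⊕ 4s+3r≤n+4 ⊕ 1+s′≤s ⊕ 1+s′≤s ⊕ 1+s′≤s ⊕ 1+s′≤s ⊕ s<r ⊕ s<r ⊕ s<r)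
          (solve (List ℕ ∋ s ∷ s′ ∷ r ∷ h ∷ n ∷ []))

      -- If the window (h, h + 2s − 1] does not beat the span of z, the point h + 4s − 3 is too
      -- late for x, too late for y and too early for z.
      probe-uncoloured : first sy < h + s → suc (n + h) ≤ h + s + s′ + fz → ⊥
      probe-uncoloured early narrower with distinct-cover x y z dist (Δ (suc (h + 4 * s′)))
      ... | inj₁ probe-x =
        past-x (right-of-hit probe-x (subst (count x (suc (h + 4 * s′)) ≤_) (sym lx-count) (count-mono x probe≤n)))
        where
        past-x : suc (h + 4 * s′) ≤ suc lx → ⊥
        past-x le = refute s′ (le ⊕ x-short ⊕ h+2≤3s ⊕ s≤1+s′ ⊕ s≤1+s′ ⊕ s≤1+s′) (solve (List ℕ ∋ lx ∷ s ∷ s′ ∷ h ∷ []))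
      ... | inj₂ (inj₁ probe-y) =
        past-y (right-of-hit probe-y
                 (subst (count y (suc (h + 4 * s′)) ≤_) (sym (last-count sy)) (count-mono y probe≤n)))
               (short sy) early
        where
        past-y : ∀ {f l} → suc (h + 4 * s′) ≤ suc l → suc (suc l) ≤ h + f → suc f ≤ h + s → ⊥
        past-y {f} {l} le short-y early-y =
          refute 0 (le ⊕ short-y ⊕ early-y ⊕ h+2≤3s ⊕ s≤1+s′ ⊕ s≤1+s′ ⊕ s≤1+s′ ⊕ s≤1+s′)
            (solve (List ℕ ∋ f ∷ l ∷ s ∷ s′ ∷ h ∷ []))
      ... | inj₂ (inj₂ probe-z) =
        before-z (left-of-hit probe-z (subst (_≤ count z (h + 4 * s′)) (sym fz-count) (count-mono z (m≤m+n h _))))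
        where
        before-z : fz ≤ h + 4 * s′ → ⊥
        before-z le =
          refute 0 (le ⊕ narrower ⊕ h+2≤3s ⊕ 4s+3r≤n+4 ⊕ 1+s′≤s ⊕ 1+s′≤s ⊕ 1+s′≤s ⊕ 1+s′≤s ⊕ 1+s′≤s ⊕ 5s≤3r+3)
            (solve (List ℕ ∋ fz ∷ s ∷ s′ ∷ r ∷ h ∷ n ∷ []))
      pair : Pair
      pair with first sy <? h + s
      ... | yes early = pair-unless-narrower (proj₂ crowded-window) fz-hit z-last z-many z-after-window ≤-refl
                          (⊥-elim ∘ probe-uncoloured early)
      ... | no late = late-y (≮⇒≥ late)

    three-large : ∀ {x y z} → Distinct x y z → (∀ e → AtLeast r e h n) → Δ (suc h) ≡ x → Δ n ≡ z → Pair
    three-large {x} {y} {z} dist large x-first z-last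
      with count-reaches x h n (count x n) (atLeast⇒count< 1≤r (large x)) ≤-refl
         | count-reaches z h n (suc (count z h)) ≤-refl (atLeast⇒count< 1≤r (large z))
    ... | lx , _ , lx<n , lx-hit , lx-reached | fz , h≤fz , _ , fz-hit , fz-reached =
      pair-unless-short x-first lx-hit x-many ≤-refl lx<n λ x-short →
      spanned (large y) λ sy →
      pair-unless-short fz-hit z-last z-many h≤fz ≤-refl λ z-short →
      ThreeLarge.pair dist lx lx-reached x-short sy fz fz-hit z-last fz-count z-many z-short
      where
      x-many : AtLeast r x h (suc lx)
      x-many = at-least (subst (r + count x h ≤_) (sym lx-reached) (counted (large x)))
      fz-count : count z fz ≡ count z h
      fz-count = count-before-hit fz-hit fz-reached
      z-many : AtLeast r z fz n
      z-many = at-least (subst (λ t → r + t ≤ count z n) (sym fz-count) (counted (large z)))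

    all-large : (∀ e → AtLeast r e h n) → Pair
    all-large large with Δ (suc h) ≟ Δ n
    ... | yes same = pair-unless-short refl (sym same) (large _) ≤-refl ≤-refl (⊥-elim ∘ too-short)
      where
      too-short : n < h + h → ⊥
      too-short n< =
        refute (2 + r) (n< ⊕ h+2≤3s ⊕ h+2≤3s ⊕ 4s+3r≤n+4 ⊕ s<r ⊕ s<r) (solve (List ℕ ∋ s ∷ r ∷ h ∷ n ∷ []))
    ... | no differ with third-colour (Δ (suc h)) (Δ n) differ
    ... | _ , dist = three-large dist large refl refl

    upper : Pair
    upper with all? (λ e → r + count e h ≤? count e n)
    ... | yes large = all-large (at-least ∘ large)
    ... | no ¬large with ¬∀⟶∃¬ 3 _ (λ e → r + count e h ≤? count e n) ¬large
    ... | a , a-small with others a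
    ... | b , c , dist@(a≢b , a≢c , b≢c) with r + count b h ≤? count b n | r + count c h ≤? count c n
    ... | yes large-b | yes large-c = two-large dist (≰⇒> a-small) (at-least large-b) (at-least large-c)
    ... | no b-small | _ =
      bounded c λ c-few → ⊥-elim (not-all-small (a≢c ∘ sym , b≢c ∘ sym , a≢b) c-few (≰⇒> a-small) (≰⇒> b-small))
    ... | yes _ | no c-small =
      bounded b λ b-few → ⊥-elim (not-all-small (a≢b ∘ sym , b≢c , a≢c) b-few (≰⇒> a-small) (≰⇒> c-small))

upper-bound : ∀ {s s′ r h n} → Parameters s s′ r h n → Good s r n
upper-bound p Δ = upper (proj₂ crowded-prefix)
  where open UpperBound p Δ

-- Colourings by blocks

-- Blocks are listed from right to left, so that the widths of prefixes nest definitionally.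
-- Points beyond the total width (and the point 0) get an arbitrary colour.
Blocks : Set
Blocks = List (ℕ × Fin 3)

width : Blocks → ℕ
width [] = 0
width ((ℓ , _) ∷ bs) = width bs + ℓ

paint : Blocks → Coloring
paint [] _ = red
paint ((ℓ , c) ∷ bs) x with x ≤? width bs
... | yes _ = paint bs x
... | no _ = c

width-++ : ∀ later bs → width bs ≤ width (later ++ bs)
width-++ [] bs = ≤-refl
width-++ ((ℓ , _) ∷ later) bs = ≤-trans (width-++ later bs) (m≤m+n _ ℓ)

paint-++ : ∀ later {bs x} → x ≤ width bs → paint (later ++ bs) x ≡ paint bs x
paint-++ [] _ = refl
paint-++ ((ℓ , c) ∷ later) {bs} {x} x≤ with x ≤? width (later ++ bs)
... | yes _ = paint-++ later x≤
... | no x≰ = ⊥-elim (x≰ (≤-trans x≤ (width-++ later bs)))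

paint-head : ∀ ℓ c pre {x} → width pre < x → paint ((ℓ , c) ∷ pre) x ≡ c
paint-head ℓ c pre {x} pre<x with x ≤? width pre
... | yes x≤ = ⊥-elim (<⇒≱ pre<x x≤)
... | no _ = refl

paint-block : ∀ later ℓ c pre {x} → width pre < x → x ≤ width pre + ℓ →
              paint (later ++ (ℓ , c) ∷ pre) x ≡ c
paint-block later ℓ c pre pre<x x≤ = trans (paint-++ later x≤) (paint-head ℓ c pre pre<x)

-- Lower bound

-- s = s′ + 1 and r = s′ + d + 1.
module LowerBound (s′ d : ℕ) (1≤d : 1 ≤ d) (d<s′ : d < s′) where

  layout : Blocks
  layout = (s′ + d , blue) ∷ (suc s′ , red) ∷ (suc (s′ + s′ + d) , green) ∷ (d , red)
         ∷ (s′ , blue) ∷ (s′ , green) ∷ (s′ , red) ∷ []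

  κ : Coloring
  κ = paint layout

  open Counting κ

  b₁ b₂ b₃ b₄ b₅ b₆ b₇ : ℕ
  b₁ = s′
  b₂ = b₁ + s′
  b₃ = b₂ + s′
  b₄ = b₃ + d
  b₅ = b₄ + suc (s′ + s′ + d)
  b₆ = b₅ + suc s′
  b₇ = b₆ + (s′ + d)

  block₁ : Block red 0 s′
  block₁ = paint-block (take 6 layout) s′ red (drop 7 layout)
  block₂ : Block green b₁ s′
  block₂ = paint-block (take 5 layout) s′ green (drop 6 layout)
  block₃ : Block blue b₂ s′
  block₃ = paint-block (take 4 layout) s′ blue (drop 5 layout)
  block₄ : Block red b₃ d
  block₄ = paint-block (take 3 layout) d red (drop 4 layout)
  block₅ : Block green b₄ (suc (s′ + s′ + d))
  block₅ = paint-block (take 2 layout) (suc (s′ + s′ + d)) green (drop 3 layout)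
  block₆ : Block red b₅ (suc s′)
  block₆ = paint-block (take 1 layout) (suc s′) red (drop 2 layout)
  block₇ : Block blue b₆ (s′ + d)
  block₇ = paint-block (take 0 layout) (s′ + d) blue (drop 1 layout)

  red₁ : count red b₁ ≡ s′
  red₁ = count-block-hit s′ block₁
  green₁ : count green b₁ ≡ 0
  green₁ = count-block-miss s′ block₁ (λ ())
  blue₁ : count blue b₁ ≡ 0
  blue₁ = count-block-miss s′ block₁ (λ ())
  red₂ : count red b₂ ≡ s′
  red₂ = trans (count-block-miss s′ block₂ (λ ())) red₁
  green₂ : count green b₂ ≡ s′
  green₂ = trans (count-block-hit s′ block₂) (cong (_+ s′) green₁)
  blue₂ : count blue b₂ ≡ 0
  blue₂ = trans (count-block-miss s′ block₂ (λ ())) blue₁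

  at-b₃ : ∀ c → count c b₃ ≡ s′
  at-b₃ red = trans (count-block-miss s′ block₃ (λ ())) red₂
  at-b₃ green = trans (count-block-miss s′ block₃ (λ ())) green₂
  at-b₃ blue = trans (count-block-hit s′ block₃) (cong (_+ s′) blue₂)

  red-after-b₃ : count red (suc b₃) ≡ suc s′
  red-after-b₃ = trans (count-hit (block₄ (n<1+n b₃) (subst (_≤ b₃ + d) (+-comm b₃ 1) (+-monoʳ-≤ b₃ 1≤d))))
                       (cong suc (at-b₃ red))
  green₄ : count green b₄ ≡ s′
  green₄ = trans (count-block-miss d block₄ (λ ())) (at-b₃ green)
  red₅ : count red b₅ ≡ s′ + d
  red₅ = trans (count-block-miss _ block₅ (λ ())) (trans (count-block-hit d block₄) (cong (_+ d) (at-b₃ red)))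
  green₅ : count green b₅ ≡ s′ + suc (s′ + s′ + d)
  green₅ = trans (count-block-hit _ block₅) (cong (_+ suc (s′ + s′ + d)) green₄)
  blue₅ : count blue b₅ ≡ s′
  blue₅ = trans (count-block-miss _ block₅ (λ ())) (trans (count-block-miss d block₄ (λ ())) (at-b₃ blue))
  red₇ : count red b₇ ≡ s′ + d + suc s′
  red₇ = trans (count-block-miss _ block₇ (λ ())) (trans (count-block-hit _ block₆) (cong (_+ suc s′) red₅))
  blue₇ : count blue b₇ ≡ s′ + (s′ + d)
  blue₇ = trans (count-block-hit _ block₇) (cong (_+ (s′ + d)) (trans (count-block-miss _ block₆ (λ ())) blue₅))

  green-location : ∀ {x} → κ x ≡ green → b₃ < x → x ≤ b₇ → b₄ < x × x ≤ b₅
  green-location {x} green-x b₃<x x≤b₇ = locate (x ≤? b₄) (x ≤? b₅) (x ≤? b₆)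
    where
    red≢green : red ≢ green
    red≢green ()
    blue≢green : blue ≢ green
    blue≢green ()
    locate : Dec (x ≤ b₄) → Dec (x ≤ b₅) → Dec (x ≤ b₆) → b₄ < x × x ≤ b₅
    locate (yes x≤b₄) _ _ = ⊥-elim (red≢green (trans (sym (block₄ b₃<x x≤b₄)) green-x))
    locate (no x≰b₄) (yes x≤b₅) _ = ≰⇒> x≰b₄ , x≤b₅
    locate (no _) (no x≰b₅) (yes x≤b₆) = ⊥-elim (red≢green (trans (sym (block₆ (≰⇒> x≰b₅) x≤b₆)) green-x))
    locate (no _) (no _) (no x≰b₆) = ⊥-elim (blue≢green (trans (sym (block₇ (≰⇒> x≰b₆) x≤b₇)) green-x))

  too-few : ∀ {x y} → suc s′ + x ≤ y → y ≤ s′ → ⊥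
  too-few {x} {y} many top = refute x (many ⊕ top) (solve (List ℕ ∋ x ∷ y ∷ s′ ∷ []))

  -- S₁ ⊆ (p₁, M₁] has colour c₁ and ends after b₃; S₂ ⊆ (p₂, M₂] lies in the green block.
  FirstBeforeGreen : Fin 3 → Set
  FirstBeforeGreen c₁ = ∀ {p₁ M₁ p₂ M₂} → AtLeast (suc s′) c₁ p₁ M₁ → AtLeast (suc (s′ + d)) green p₂ M₂ →
                        M₁ ≤ p₂ → M₁ + suc p₂ ≤ M₂ + suc p₁ → b₃ < M₁ → b₄ ≤ p₂ → M₂ ≤ b₅ → ⊥

  blue-before-green : FirstBeforeGreen blue
  blue-before-green {M₁ = M₁} (at-least many₁) many₂ M₁≤p₂ _ _ _ M₂≤b₅ =
    too-few many₁ (subst (count blue M₁ ≤_) blue₅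
                         (count-mono blue (≤-trans M₁≤p₂ (≤-trans (<⇒≤ (atLeast⇒< (s≤s z≤n) many₂)) M₂≤b₅))))

  -- S₁ starting after b₁ has too few red points; starting before b₁ it is wider than S₂.
  red-before-green : FirstBeforeGreen red
  red-before-green {p₁} {M₁} {p₂} {M₂} (at-least many₁) many₂ M₁≤p₂ widths b₃<M₁ b₄≤p₂ M₂≤b₅ with b₁ ≤? p₁
  ... | yes b₁≤p₁ =
    arith many₁ (subst (count red M₁ ≤_) red₅ (count-mono red M₁≤b₅))
                (subst (_≤ count red p₁) red₁ (count-mono red b₁≤p₁))
    where
    M₁≤b₅ : M₁ ≤ b₅
    M₁≤b₅ = ≤-trans M₁≤p₂ (≤-trans (<⇒≤ (atLeast⇒< (s≤s z≤n) many₂)) M₂≤b₅)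
    arith : ∀ {x y} → suc s′ + x ≤ y → y ≤ s′ + d → s′ ≤ x → ⊥
    arith {x} {y} many top bottom = refute 1 (many ⊕ top ⊕ bottom ⊕ d<s′) (solve (List ℕ ∋ x ∷ y ∷ s′ ∷ d ∷ []))
  ... | no b₁≰p₁ =
    arith (count-total ((λ ()) , (λ ()) , (λ ())) p₁)
          (subst (count green p₁ ≤_) green₁ (count-mono green p₁≤b₁))
          (subst (count blue p₁ ≤_) blue₁ (count-mono blue p₁≤b₁))
          many₁ (subst (λ t → count red M₁ + b₃ ≤ t + M₁) (at-b₃ red) (count-gap red (<⇒≤ b₃<M₁)))
          widths M₂≤b₅ b₄≤p₂
    where
    p₁≤b₁ : p₁ ≤ b₁
    p₁≤b₁ = <⇒≤ (≰⇒> b₁≰p₁)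
    arith : ∀ {x y g b} → x + g + b ≡ p₁ → g ≤ 0 → b ≤ 0 → suc s′ + x ≤ y → y + (s′ + s′ + s′) ≤ s′ + M₁ →
            M₁ + suc p₂ ≤ M₂ + suc p₁ → M₂ ≤ s′ + s′ + s′ + d + suc (s′ + s′ + d) → s′ + s′ + s′ + d ≤ p₂ → ⊥
    arith {x} {y} {g} {b} total g≤0 b≤0 many gap widths M₂≤ ≤p₂ =
      refute 0 (≤-reflexive (sym total) ⊕ g≤0 ⊕ b≤0 ⊕ many ⊕ gap ⊕ widths ⊕ M₂≤ ⊕ ≤p₂ ⊕ d<s′)
        (solve (List ℕ ∋ x ∷ y ∷ g ∷ b ∷ p₁ ∷ M₁ ∷ p₂ ∷ M₂ ∷ s′ ∷ d ∷ []))

  -- S₁ starting after b₂ leaves too few green points for S₂; S₁ starting before b₂ is too short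
  -- unless it reaches the green block, and then it is wider than S₂.
  green-before-green : FirstBeforeGreen green
  green-before-green {p₁} {M₁} {p₂} {M₂} (at-least many₁) (at-least many₂) M₁≤p₂ widths b₃<M₁ b₄≤p₂ M₂≤b₅
    with b₂ ≤? p₁
  ... | yes b₂≤p₁ =
    arith many₁ (subst (_≤ count green p₁) green₂ (count-mono green b₂≤p₁)) (count-mono green M₁≤p₂)
          many₂ (subst (count green M₂ ≤_) green₅ (count-mono green M₂≤b₅))
    where
    arith : ∀ {x y z w} → suc s′ + x ≤ y → s′ ≤ x → y ≤ z → suc (s′ + d) + z ≤ w → w ≤ s′ + suc (s′ + s′ + d) → ⊥
    arith {x} {y} {z} {w} many₁ bottom middle many₂ top =
      refute 0 (many₁ ⊕ bottom ⊕ middle ⊕ many₂ ⊕ top) (solve (List ℕ ∋ x ∷ y ∷ z ∷ w ∷ s′ ∷ d ∷ []))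
  ... | no b₂≰p₁ with b₄ ≤? M₁
  ...   | no b₄≰M₁ = too-few many₁ (subst (count green M₁ ≤_) green₄ (count-mono green (<⇒≤ (≰⇒> b₄≰M₁))))
  ...   | yes b₄≤M₁ =
    arith (count-total ((λ ()) , (λ ()) , (λ ())) p₁)
          (subst (count red p₁ ≤_) red₂ (count-mono red p₁≤b₂))
          (subst (count blue p₁ ≤_) blue₂ (count-mono blue p₁≤b₂))
          many₁ (subst (λ t → count green M₁ + b₄ ≤ t + M₁) green₄ (count-gap green b₄≤M₁))
          widths M₂≤b₅ M₁≤p₂
    where
    p₁≤b₂ : p₁ ≤ b₂
    p₁≤b₂ = <⇒≤ (≰⇒> b₂≰p₁)
    arith : ∀ {ρ x β y} → ρ + x + β ≡ p₁ → ρ ≤ s′ → β ≤ 0 → suc s′ + x ≤ y → y + (s′ + s′ + s′ + d) ≤ s′ + M₁ →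
            M₁ + suc p₂ ≤ M₂ + suc p₁ → M₂ ≤ s′ + s′ + s′ + d + suc (s′ + s′ + d) → M₁ ≤ p₂ → ⊥
    arith {ρ} {x} {β} {y} total ρ≤ β≤0 many gap widths M₂≤ M₁≤p₂ =
      refute x (≤-reflexive (sym total) ⊕ ρ≤ ⊕ β≤0 ⊕ many ⊕ many ⊕ gap ⊕ gap ⊕ widths ⊕ M₂≤ ⊕ M₁≤p₂)
        (solve (List ℕ ∋ ρ ∷ x ∷ β ∷ y ∷ p₁ ∷ M₁ ∷ p₂ ∷ M₂ ∷ s′ ∷ d ∷ []))

  separated-runs : ∀ {c₁ c₂ p₁ M₁ p₂ M₂} → AtLeast (suc s′) c₁ p₁ M₁ → AtLeast (suc (s′ + d)) c₂ p₂ M₂ →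
                   M₁ ≤ p₂ → M₁ + suc p₂ ≤ M₂ + suc p₁ → M₂ ≤ b₇ →
                   (c₂ ≡ green → b₃ < M₁ → b₄ ≤ p₂ × M₂ ≤ b₅) → ⊥
  separated-runs {M₁ = M₁} _ _ _ _ _ _ with M₁ ≤? b₃
  separated-runs {c₁} {M₁ = M₁} (at-least many₁) _ _ _ _ _ | yes M₁≤b₃ =
    too-few many₁ (subst (count c₁ M₁ ≤_) (at-b₃ c₁) (count-mono c₁ M₁≤b₃))
  separated-runs {c₂ = red} {p₂ = p₂} {M₂} _ (at-least many₂) M₁≤p₂ _ M₂≤b₇ _ | no M₁≰b₃ =
    arith many₂ (subst (count red M₂ ≤_) red₇ (count-mono red M₂≤b₇))
          (subst (_≤ count red p₂) red-after-b₃ (count-mono red (≤-trans (≰⇒> M₁≰b₃) M₁≤p₂)))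
    where
    arith : ∀ {x y} → suc (s′ + d) + x ≤ y → y ≤ s′ + d + suc s′ → suc s′ ≤ x → ⊥
    arith {x} {y} many top bottom = refute 0 (many ⊕ top ⊕ bottom) (solve (List ℕ ∋ x ∷ y ∷ s′ ∷ d ∷ []))
  separated-runs {c₂ = blue} {p₂ = p₂} {M₂} _ (at-least many₂) M₁≤p₂ _ M₂≤b₇ _ | no M₁≰b₃ =
    arith many₂ (subst (count blue M₂ ≤_) blue₇ (count-mono blue M₂≤b₇))
          (subst (_≤ count blue p₂) (at-b₃ blue) (count-mono blue (≤-trans (<⇒≤ (≰⇒> M₁≰b₃)) M₁≤p₂)))
    where
    arith : ∀ {x y} → suc (s′ + d) + x ≤ y → y ≤ s′ + (s′ + d) → s′ ≤ x → ⊥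
    arith {x} {y} many top bottom = refute 0 (many ⊕ top ⊕ bottom) (solve (List ℕ ∋ x ∷ y ∷ s′ ∷ d ∷ []))
  separated-runs {c₁} {c₂ = green} {p₂ = p₂} {M₂} many₁ many₂ M₁≤p₂ widths _ locate | no M₁≰b₃ =
    first-before-green c₁ many₁ many₂ M₁≤p₂ widths (≰⇒> M₁≰b₃) (proj₁ located) (proj₂ located)
    where
    located : b₄ ≤ p₂ × M₂ ≤ b₅
    located = locate refl (≰⇒> M₁≰b₃)
    first-before-green : ∀ c₁ → FirstBeforeGreen c₁
    first-before-green red = red-before-green
    first-before-green green = green-before-green
    first-before-green blue = blue-before-green

  no-pair : ∀ {m} → m ≤ b₇ → ¬ GoodPair (suc s′) (suc (s′ + d)) m κ
  no-pair {m} m≤b₇ (S₁ , S₂ , mono₁ , mono₂ , max₁<min₂ , diam≤)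
    with monochromatic-run (s≤s z≤n) mono₁ | monochromatic-run (s≤s z≤n) mono₂
  ... | c₁ , p₁ , min₁ , many₁ , _ , _ | c₂ , p₂ , min₂ , many₂ , M₂≤m , points₂ =
    separated-runs many₁ many₂ M₁≤p₂ widths (≤-trans M₂≤m m≤b₇) locate
    where
    M₁≤p₂ : maxL S₁ ≤ p₂
    M₁≤p₂ = s≤s⁻¹ (subst (maxL S₁ <_) min₂ max₁<min₂)
    widths : maxL S₁ + suc p₂ ≤ maxL S₂ + suc p₁
    widths = ∸≤∸⇒+≤+ (atLeast⇒< (s≤s z≤n) many₁) (atLeast⇒< (s≤s z≤n) many₂)
                     (subst₂ (λ u v → maxL S₁ ∸ u ≤ maxL S₂ ∸ v) min₁ min₂ diam≤)
    locate : c₂ ≡ green → b₃ < maxL S₁ → b₄ ≤ p₂ × maxL S₂ ≤ b₅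
    locate refl b₃<M₁ = ≤-minL S₂ (all-map proj₁ located) min₂ , maxL-≤ (all-map proj₂ located)
      where
      located : All (λ x → b₄ < x × x ≤ b₅) S₂
      located = all-map (λ (green-x , p₂<x , x≤M₂) → green-location green-x
                                                       (<-≤-trans b₃<M₁ (≤-trans M₁≤p₂ (<⇒≤ p₂<x)))
                                                       (≤-trans x≤M₂ (≤-trans M₂≤m m≤b₇)))
                        (proj₂ points₂)

lower-bound : ∀ s′ d → 1 ≤ d → d < s′ → ∀ {m} → m ≤ 7 * s′ + 3 * d + 2 → ¬ Good (suc s′) (suc (s′ + d)) m
lower-bound s′ d 1≤d d<s′ {m} m≤ good = no-pair (subst (m ≤_) total-width m≤) (good κ)
  where
  open LowerBound s′ d 1≤d d<s′
  total-width : 7 * s′ + 3 * d + 2 ≡ s′ + s′ + s′ + d + suc (s′ + s′ + d) + suc s′ + (s′ + d)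
  total-width = solve (List ℕ ∋ s′ ∷ d ∷ [])

floor-bound : ∀ s r → (5 * s ∸ 1) / 3 ∸ 1 < r → 5 * s ≤ 3 * r + 3
floor-bound s r q∸1<r = begin
  5 * s                          ≤⟨ m≤n+m∸n (5 * s) 1 ⟩
  1 + (5 * s ∸ 1)                ≡⟨ cong (1 +_) (m≡m%n+[m/n]*n (5 * s ∸ 1) 3) ⟩
  1 + ((5 * s ∸ 1) % 3 + q * 3)  ≤⟨ +-monoʳ-≤ 1 (+-mono-≤ (s≤s⁻¹ (m%n<n (5 * s ∸ 1) 3)) (*-monoˡ-≤ 3 q≤r)) ⟩
  1 + (2 + r * 3)                ≡⟨ solve (List ℕ ∋ r ∷ []) ⟩
  3 * r + 3                      ∎
  where
  open ≤-Reasoning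
  q : ℕ
  q = (5 * s ∸ 1) / 3
  q≤r : q ≤ r
  q≤r = ≤-trans (m≤n+m∸n q 1) q∸1<r

regime : ∀ {s′ r} → 3 ≤ suc s′ → 5 * suc s′ ≤ 3 * r + 3 →
         Parameters (suc s′) s′ r (3 * suc s′ ∸ 2) (4 * suc s′ + 3 * r ∸ 4)
regime {s′} {r} 3≤s 5s≤3r+3 = record
  { s≡1+s′ = refl
  ; s<r = ≮⇒≥ r≤s-absurd
  ; 3s≤2r+2 = ≮⇒≥ 2r+2<3s-absurd
  ; 5s≤3r+3 = 5s≤3r+3
  ; h+2≡3s = m∸n+n≡m (≤-trans (≤-trans (n≤1+n 2) 3≤s) (m≤n*m (suc s′) 3))
  ; n+4≡4s+3r = m∸n+n≡m (≤-trans (*-monoʳ-≤ 4 (s≤s z≤n)) (m≤m+n (4 * suc s′) (3 * r)))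
  }
  where
  r≤s-absurd : r < suc (suc s′) → ⊥
  r≤s-absurd r≤s = refute 2 (r≤s ⊕ r≤s ⊕ r≤s ⊕ 5s≤3r+3 ⊕ 3≤s ⊕ 3≤s) (solve (List ℕ ∋ s′ ∷ r ∷ []))
  2r+2<3s-absurd : 2 * r + 2 < 3 * suc s′ → ⊥
  2r+2<3s-absurd lt = refute (3 + s′) (lt ⊕ lt ⊕ lt ⊕ 5s≤3r+3 ⊕ 5s≤3r+3) (solve (List ℕ ∋ s′ ∷ r ∷ []))

n-value : ∀ s′ d → 4 * suc s′ + 3 * suc (s′ + d) ∸ 4 ≡ suc (7 * s′ + 3 * d + 2)
n-value s′ d = trans (cong (_∸ 4) expand) (m+n∸n≡m _ 4)
  where
  expand : 4 * suc s′ + 3 * suc (s′ + d) ≡ suc (7 * s′ + 3 * d + 2) + 4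
  expand = solve (List ℕ ∋ s′ ∷ d ∷ [])

excess<s′ : ∀ {s′ d} → suc (s′ + d) ≤ 2 * suc s′ ∸ 2 → d < s′
excess<s′ {s′} {d} r≤2s∸2 = ≮⇒≥ absurd
  where
  r+2≤2s : suc (s′ + d) + 2 ≤ 2 * suc s′
  r+2≤2s = ≤-trans (+-monoˡ-≤ 2 r≤2s∸2) (≤-reflexive (m∸n+n≡m (*-monoʳ-≤ 2 (s≤s z≤n))))
  absurd : s′ < suc d → ⊥
  absurd s′≤d = refute 0 (s′≤d ⊕ r+2≤2s) (solve (List ℕ ∋ s′ ∷ d ∷ []))

theorem4p4 : (r s : ℕ) → 3 ≤ s → s ≤ r
    → ((5 * s ∸ 1) / 3) ∸ 1 < r → r ≤ 2 * s ∸ 2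
    → IsF3 s r (4 * s + 3 * r ∸ 4)
theorem4p4 r (suc s′) 3≤s s≤r floor r≤2s∸2 = 1≤n , upper-bound parameters , no-smaller
  where
  parameters : Parameters (suc s′) s′ r (3 * suc s′ ∸ 2) (4 * suc s′ + 3 * r ∸ 4)
  parameters = regime 3≤s (floor-bound (suc s′) r floor)
  d : ℕ
  d = r ∸ suc s′
  1+s′+d≡r : suc (s′ + d) ≡ r
  1+s′+d≡r = m+[n∸m]≡n s≤r
  n≡ : 4 * suc s′ + 3 * r ∸ 4 ≡ suc (7 * s′ + 3 * d + 2)
  n≡ = subst (λ t → 4 * suc s′ + 3 * t ∸ 4 ≡ suc (7 * s′ + 3 * d + 2)) 1+s′+d≡r (n-value s′ d)
  1≤n : 1 ≤ 4 * suc s′ + 3 * r ∸ 4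
  1≤n = subst (1 ≤_) (sym n≡) (s≤s z≤n)
  no-smaller : ∀ m → 1 ≤ m → m < 4 * suc s′ + 3 * r ∸ 4 → ¬ Good (suc s′) r m
  no-smaller m _ m<n = subst (λ t → ¬ Good (suc s′) t m) 1+s′+d≡r
    (lower-bound s′ d (m<n⇒0<n∸m (Parameters.s<r parameters))
                      (excess<s′ (subst (_≤ 2 * suc s′ ∸ 2) (sym 1+s′+d≡r) r≤2s∸2))
                      (s≤s⁻¹ (subst (m <_) n≡ m<n)))
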